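{- The logic $\mathrm{TeamLTL}^l$ (LTL formulae in negation normal form evaluated under the lax team semantics $\models^l$) satisfies downward closure, the empty team property, singleton equivalence and flatness; that is, for every such formula $\varphi$, every team $T$ and every trace $t$: (1) if $T\models^l\varphi$ and $S\subseteq T$ then $S\models^l\varphi$; (2) $\emptyset\models^l\varphi$; (3) $\{t\}\models^l\varphi$ iff $t\models\varphi$; (4) $T\models^l\varphi$ iff $\{s\}\models^l\varphi$ for all $s\in T$.
   Context: A trace over a set $\mathrm{AP}$ of atomic propositions is an infinite sequence $t\in(2^{\mathrm{AP}})^\omega$; $t[i,\infty]$ is its suffix from position $i$. A team is a set of traces. LTL formulae (in negation normal form) are built by $\varphi::=p\mid\neg p\mid\varphi\lor\varphi\mid\varphi\land\varphi\mid \mathsf{X}\varphi\mid\mathsf{G}\varphi\mid\varphi\,\mathsf{U}\,\varphi$ ($p\in\mathrm{AP}$), with the usual semantics $t\models\varphi$ on single traces. Lax team semantics: write $\mathcal P(\mathbb N)^+$ for the nonempty subsets of $\mathbb N$; for $f:T\to\mathcal P(\mathbb N)^+$ put $T[f,\infty]=\{t[s,\infty]\mid t\in T, s\in f(t)\}$, and $T[1,\infty]=\{t[1,\infty]\mid t\in T\}$. For $T'\subseteq T$, $f:T\to\mathcal P(\mathbb N)^+$, $f':T'\to\mathcal P(\mathbb N)^+$, write $f'<f$ iff for all $t\in T'$: $\min f'(t)\le\min f(t)$ and $\max f'(t)<\max f(t)$ (the latter required only when $\max f(t)$ exists). Then: $T\models^l l$ (literal $l$) iff $t\models l$ for all $t\in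 T$; $T\models^l\varphi\land\psi$ iff both hold; $T\models^l\varphi\lor\psi$ iff there are $T_1\cup T_2=T$ with $T_1\models^l\varphi$, $T_2\models^l\psi$; $T\models^l\mathsf X\varphi$ iff $T[1,\infty]\models^l\varphi$; $T\models^l\mathsf G\varphi$ iff $T[f,\infty]\models^l\varphi$ for all $f:T\to\mathcal P(\mathbb N)^+$; $T\models^l\varphi\,\mathsf U\,\psi$ iff there is $f:T\to\mathcal P(\mathbb N)^+$ with $T[f,\infty]\models^l\psi$ and, for $T'=\{t\in T\mid f(t)\neq\{0\}\}$, for every $f':T'\to\mathcal P(\mathbb N)^+$ with $f'<f$ we have $T'[f',\infty]\models^l\varphi$ or $T'=\emptyset$. -}

module Defs where

open import Level using (Level) renaming (suc to lsuc; zero to lzero)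
open import Data.Nat using (ℕ; zero; suc; _+_; _≤_; _<_; _≡ᵇ_)
open import Data.Bool using (Bool; true; false)
open import Data.Product using (Σ; Σ-syntax; ∃; ∃-syntax; _×_; _,_; proj₁; proj₂)
open import Data.Sum using (_⊎_)
open import Data.Empty using (⊥)
open import Relation.Nullary using (¬_)
open import Relation.Binary.PropositionalEquality using (_≡_)
open import Function.Bundles using (_⇔_)

SubsetN : Set
SubsetN = ℕ → Bool

_∈ₙ_ : ℕ → SubsetN → Set
n ∈ₙ A = A n ≡ true

Subset⁺ : Set
Subset⁺ = Σ SubsetN (λ A → ∃[ n ] n ∈ₙ A)

IsMin : SubsetN → ℕ → Set
IsMin A m = m ∈ₙ A × (∀ n → n ∈ₙ A → m ≤ n)

IsMax : SubsetN → ℕ → Set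
IsMax A m = m ∈ₙ A × (∀ n → n ∈ₙ A → n ≤ m)

IsZeroSingleton : SubsetN → Set
IsZeroSingleton A = ∀ n → A n ≡ (n ≡ᵇ 0)

_<ₛ_ : Subset⁺ → Subset⁺ → Set
A' <ₛ A =
  (∀ m m' → IsMin (proj₁ A) m → IsMin (proj₁ A') m' → m' ≤ m)
  × (∀ m → IsMax (proj₁ A) m → Σ[ m' ∈ ℕ ] (IsMax (proj₁ A') m' × m' < m))

module _ {AP : Set} where

  Trace : Set
  Trace = ℕ → (AP → Bool)

  suffix : Trace → ℕ → Trace
  suffix t i = λ n → t (i + n)

  Team : Set₁
  Team = Trace → Set

  _⊆_ : Team → Team → Set
  S ⊆ T = ∀ t → S t → T t

  ∅ : Team
  ∅ _ = ⊥

  ⟦_⟧ : Trace → Team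
  ⟦ t ⟧ u = u ≡ t

  TeamFun : Team → Set
  TeamFun T = (t : Trace) → T t → Subset⁺

  _[_,∞] : (T : Team) → TeamFun T → Team
  (T [ f ,∞]) u = Σ[ t ∈ Trace ] Σ[ p ∈ T t ] Σ[ s ∈ ℕ ] (s ∈ₙ proj₁ (f t p) × u ≡ suffix t s)

  _[1,∞] : Team → Team
  (T [1,∞]) u = Σ[ t ∈ Trace ] (T t × u ≡ suffix t 1)

  nonZeroPart : (T : Team) → TeamFun T → Team
  nonZeroPart T f t = Σ[ p ∈ T t ] ¬ IsZeroSingleton (proj₁ (f t p))

  Below : (T : Team) (f : TeamFun T) → TeamFun (nonZeroPart T f) → Set
  Below T f f' = ∀ t (q : nonZeroPart T f t) → f' t q <ₛ f t (proj₁ q)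

data Formula (AP : Set) : Set where
  lit    : AP → Formula AP
  nlit   : AP → Formula AP
  _∨′_   : Formula AP → Formula AP → Formula AP
  _∧′_   : Formula AP → Formula AP → Formula AP
  X′     : Formula AP → Formula AP
  G′     : Formula AP → Formula AP
  _U′_   : Formula AP → Formula AP → Formula AP

module _ {AP : Set} where

  _⊨_ : Trace {AP} → Formula AP → Set
  t ⊨ lit p  = t 0 p ≡ true
  t ⊨ nlit p = t 0 p ≡ false
  t ⊨ (φ ∨′ ψ) = (t ⊨ φ) ⊎ (t ⊨ ψ)
  t ⊨ (φ ∧′ ψ) = (t ⊨ φ) × (t ⊨ ψ)
  t ⊨ X′ φ = suffix t 1 ⊨ φ
  t ⊨ G′ φ = ∀ i → suffix t i ⊨ φ
  t ⊨ (φ U′ ψ) = Σ[ k ∈ ℕ ] ((suffix t k ⊨ ψ) × (∀ j → j < k → suffix t j ⊨ φ))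

  _⊨ˡ_ : Team {AP} → Formula AP → Set₁
  T ⊨ˡ lit p  = Level.Lift (lsuc lzero) (∀ t → T t → t ⊨ lit p)
  T ⊨ˡ nlit p = Level.Lift (lsuc lzero) (∀ t → T t → t ⊨ nlit p)
  T ⊨ˡ (φ ∧′ ψ) = (T ⊨ˡ φ) × (T ⊨ˡ ψ)
  T ⊨ˡ (φ ∨′ ψ) = Σ[ T₁ ∈ Team ] Σ[ T₂ ∈ Team ]
      ((T₁ ⊆ T) × (T₂ ⊆ T) × (∀ t → T t → T₁ t ⊎ T₂ t) × (T₁ ⊨ˡ φ) × (T₂ ⊨ˡ ψ))
  T ⊨ˡ X′ φ = (T [1,∞]) ⊨ˡ φ
  T ⊨ˡ G′ φ = (f : TeamFun T) → (T [ f ,∞]) ⊨ˡ φ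
  T ⊨ˡ (φ U′ ψ) = Σ[ f ∈ TeamFun T ]
      (((T [ f ,∞]) ⊨ˡ ψ) ×
       ((f' : TeamFun (nonZeroPart T f)) → Below T f f' →
          ((nonZeroPart T f [ f' ,∞]) ⊨ˡ φ) ⊎ Level.Lift (lsuc lzero) (∀ t → ¬ nonZeroPart T f t)))

-- All four properties follow from one characterisation: T ⊨ˡ φ holds iff every trace of T
-- satisfies φ, proved by induction on φ. For disjunction split T according to which disjunct
-- each trace satisfies; for G apply the hypothesis to the singletons f(t) = {i}. For until,
-- choose f(t) = {k_t} with k_t a witness for t, so that every f' < f selects positions below
-- k_t; conversely, from an arbitrary f read off k_t := min f(t) and test the φ-part on the
-- particular f'(t) = {0, …, k_t − 1} (read as {0} when k_t = 0), which is below f.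
module Submission where

open import Defs
open import Level using (lift; lower)
open import Data.Nat using (ℕ; zero; suc; pred; _≤_; _<_; _≤ᵇ_; _≡ᵇ_; z≤n; s≤s)
open import Data.Nat.Properties
  using (≤-refl; ≤-reflexive; ≤-trans; <-≤-trans; m≤n⇒m<n∨m≡n; ≤-<-trans; ≮⇒≥; n≮0; <⇒≤pred; ≤ᵇ⇒≤; ≤⇒≤ᵇ; ≡ᵇ⇒≡; ≡⇒≡ᵇ)
open import Data.Bool using (true; false)
open import Data.Bool.Properties using (T-≡)
open import Data.Product using (Σ; _×_; _,_; proj₁; proj₂)
open import Data.Sum using (_⊎_; inj₁; inj₂)
open import Data.Empty using (⊥-elim)
open import Function.Bundles using (_⇔_; mk⇔; Equivalence)
open import Function.Construct.Composition using (_⇔-∘_)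
open import Relation.Nullary using (¬_)
open import Relation.Binary.PropositionalEquality using (_≡_; refl; sym; trans; subst)

open Equivalence using (to; from)

singletonₙ : ℕ → Subset⁺
singletonₙ k = (λ n → n ≡ᵇ k) , k , to T-≡ (≡⇒≡ᵇ k k refl)

atMostₙ : ℕ → Subset⁺
atMostₙ m = (λ n → n ≤ᵇ m) , 0 , refl

∈-singletonₙ⁻ : ∀ {n k} → n ∈ₙ proj₁ (singletonₙ k) → n ≡ k
∈-singletonₙ⁻ {n} {k} n∈ = ≡ᵇ⇒≡ n k (from T-≡ n∈)

∈-atMostₙ⁺ : ∀ {n m} → n ≤ m → n ∈ₙ proj₁ (atMostₙ m)
∈-atMostₙ⁺ n≤m = to T-≡ (≤⇒≤ᵇ n≤m)

∈-atMostₙ⁻ : ∀ {n m} → n ∈ₙ proj₁ (atMostₙ m) → n ≤ m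
∈-atMostₙ⁻ {n} {m} n∈ = ≤ᵇ⇒≤ n m (from T-≡ n∈)

isMax-singletonₙ : ∀ k → IsMax (proj₁ (singletonₙ k)) k
isMax-singletonₙ k = proj₂ (proj₂ (singletonₙ k)) , λ n n∈ → ≤-reflexive (∈-singletonₙ⁻ n∈)

isMax-atMostₙ : ∀ m → IsMax (proj₁ (atMostₙ m)) m
isMax-atMostₙ m = ∈-atMostₙ⁺ {m} ≤-refl , λ n → ∈-atMostₙ⁻

module _ {A : SubsetN} where

  isMin-if-absentBelow : ∀ {m} → m ∈ₙ A → (∀ j → j < m → ¬ j ∈ₙ A) → IsMin A m
  isMin-if-absentBelow m∈ absent = m∈ , λ n n∈ → ≮⇒≥ (λ n<m → absent n n<m n∈)

  minimumOrAbsentBelow : ∀ b → Σ ℕ (IsMin A) ⊎ (∀ j → j < b → ¬ j ∈ₙ A)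
  minimumOrAbsentBelow zero = inj₂ λ _ ()
  minimumOrAbsentBelow (suc b) with minimumOrAbsentBelow b
  ... | inj₁ min = inj₁ min
  ... | inj₂ absent with A b in Ab
  ...   | true  = inj₁ (b , isMin-if-absentBelow Ab absent)
  ...   | false = inj₂ absentBelowSuc
    where
    absentBelowSuc : ∀ j → j < suc b → ¬ j ∈ₙ A
    absentBelowSuc j (s≤s j≤b) j∈ with m≤n⇒m<n∨m≡n j≤b
    ... | inj₁ j<b  = absent j j<b j∈
    ... | inj₂ refl with trans (sym j∈) Ab
    ...   | ()

  ¬zeroSingleton-if-min>0 : ∀ {m} → IsMin A m → 0 < m → ¬ IsZeroSingleton A
  ¬zeroSingleton-if-min>0 (_ , min≤) 0<m zero≐ = n≮0 (<-≤-trans 0<m (min≤ 0 (zero≐ 0)))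

  -- Since pred 0 = 0, the case m = 0 needs A ≠ {0}.
  pred-min<max : ∀ {m M} → ¬ IsZeroSingleton A → IsMin A m → IsMax A M → pred m < M
  pred-min<max {suc m} _ (_ , min≤) (M∈ , _) = min≤ _ M∈
  pred-min<max {zero} {suc M} _ _ _ = s≤s z≤n
  pred-min<max {zero} {zero} ¬zero≐ (0∈ , _) (_ , ≤0) = ⊥-elim (¬zero≐ zero≐)
    where
    zero≐ : IsZeroSingleton A
    zero≐ zero = 0∈
    zero≐ (suc n) with A (suc n) in Asn
    ... | false = refl
    ... | true with ≤0 (suc n) Asn
    ...   | ()

minimum : (A : Subset⁺) → Σ ℕ (IsMin (proj₁ A))
minimum (A , n , n∈) with minimumOrAbsentBelow {A} (suc n)
... | inj₁ min    = min
... | inj₂ absent = ⊥-elim (absent n ≤-refl n∈)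

atMostₙ-pred-min<ₛ : (A : Subset⁺) → ¬ IsZeroSingleton (proj₁ A)
  → ∀ {m} → IsMin (proj₁ A) m → atMostₙ (pred m) <ₛ A
atMostₙ-pred-min<ₛ A ¬zero≐ {m} minA =
  (λ _ _ _ (_ , min≤) → ≤-trans (min≤ 0 (∈-atMostₙ⁺ {0} {pred m} z≤n)) z≤n) ,
  (λ M maxA → pred m , isMax-atMostₙ (pred m) , pred-min<max ¬zero≐ minA maxA)

<ₛ-singletonₙ : ∀ {A' n} k → A' <ₛ singletonₙ k → n ∈ₙ proj₁ A' → n < k
<ₛ-singletonₙ k (_ , max<) n∈ with max< k (isMax-singletonₙ k)
... | _ , (_ , ≤M') , M'<k = ≤-<-trans (≤M' _ n∈) M'<k

module _ {AP : Set} where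

  suffixes-⊆ : {T P : Team {AP}} (f : TeamFun T)
    → (∀ t (Tt : T t) s → s ∈ₙ proj₁ (f t Tt) → P (suffix t s)) → (T [ f ,∞]) ⊆ P
  suffixes-⊆ _ h _ (t , Tt , s , s∈ , refl) = h t Tt s s∈

  sound : (φ : Formula AP) {T : Team {AP}} → T ⊨ˡ φ → T ⊆ (_⊨ φ)
  sound (lit p) T⊨p = lower T⊨p
  sound (nlit p) T⊨¬p = lower T⊨¬p
  sound (φ ∨′ ψ) (T₁ , T₂ , _ , _ , cover , T₁⊨φ , T₂⊨ψ) s Ts with cover s Ts
  ... | inj₁ T₁s = inj₁ (sound φ T₁⊨φ s T₁s)
  ... | inj₂ T₂s = inj₂ (sound ψ T₂⊨ψ s T₂s)
  sound (φ ∧′ ψ) (T⊨φ , T⊨ψ) s Ts = sound φ T⊨φ s Ts , sound ψ T⊨ψ s Ts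
  sound (X′ φ) T⊨Xφ s Ts = sound φ T⊨Xφ (suffix s 1) (s , Ts , refl)
  sound (G′ φ) T⊨Gφ s Ts i =
    sound φ (T⊨Gφ (λ _ _ → singletonₙ i)) (suffix s i) (s , Ts , i , proj₂ (proj₂ (singletonₙ i)) , refl)
  sound (φ U′ ψ) {T} (f , ψ-part , φ-part) s Ts =
    k , sound ψ ψ-part (suffix s k) (s , Ts , k , proj₁ min-k , refl) , before-k
    where
    k : ℕ
    k = proj₁ (minimum (f s Ts))
    min-k : IsMin (proj₁ (f s Ts)) k
    min-k = proj₂ (minimum (f s Ts))

    f' : TeamFun (nonZeroPart T f)
    f' t (Tt , _) = atMostₙ (pred (proj₁ (minimum (f t Tt))))

    f'<f : Below T f f'
    f'<f t (Tt , ¬zero≐) = atMostₙ-pred-min<ₛ (f t Tt) ¬zero≐ (proj₂ (minimum (f t Tt)))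

    s-nonZero : ∀ {j} → j < k → nonZeroPart T f s
    s-nonZero j<k = Ts , ¬zeroSingleton-if-min>0 min-k (≤-<-trans z≤n j<k)

    before-k : ∀ j → j < k → suffix s j ⊨ φ
    before-k j j<k with φ-part f' f'<f
    ... | inj₁ φ-holds =
      sound φ φ-holds (suffix s j) (s , s-nonZero j<k , j , ∈-atMostₙ⁺ (<⇒≤pred j<k) , refl)
    ... | inj₂ (lift empty) = ⊥-elim (empty s (s-nonZero j<k))

  complete : (φ : Formula AP) {T : Team {AP}} → T ⊆ (_⊨ φ) → T ⊨ˡ φ
  complete (lit p) T⊨p = lift T⊨p
  complete (nlit p) T⊨¬p = lift T⊨¬p
  complete (φ ∨′ ψ) {T} T⊨φ∨ψ =
    (λ s → T s × s ⊨ φ) , (λ s → T s × s ⊨ ψ) , (λ _ → proj₁) , (λ _ → proj₁) , cover ,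
    complete φ (λ _ → proj₂) , complete ψ (λ _ → proj₂)
    where
    cover : ∀ t → T t → (T t × t ⊨ φ) ⊎ (T t × t ⊨ ψ)
    cover t Tt with T⊨φ∨ψ t Tt
    ... | inj₁ t⊨φ = inj₁ (Tt , t⊨φ)
    ... | inj₂ t⊨ψ = inj₂ (Tt , t⊨ψ)
  complete (φ ∧′ ψ) T⊨φ∧ψ =
    complete φ (λ s Ts → proj₁ (T⊨φ∧ψ s Ts)) , complete ψ (λ s Ts → proj₂ (T⊨φ∧ψ s Ts))
  complete (X′ φ) T⊨Xφ = complete φ λ { _ (t , Tt , refl) → T⊨Xφ t Tt }
  complete (G′ φ) T⊨Gφ f = complete φ (suffixes-⊆ f λ t Tt i _ → T⊨Gφ t Tt i)
  complete (φ U′ ψ) {T} T⊨φUψ =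
    f , complete ψ (suffixes-⊆ f at-witness) ,
    λ f' f'<f → inj₁ (complete φ (suffixes-⊆ f' (before-witness f' f'<f)))
    where
    witness : ∀ t → T t → ℕ
    witness t Tt = proj₁ (T⊨φUψ t Tt)

    f : TeamFun T
    f t Tt = singletonₙ (witness t Tt)

    at-witness : ∀ t Tt s → s ∈ₙ proj₁ (f t Tt) → suffix t s ⊨ ψ
    at-witness t Tt s s∈ =
      subst (λ i → suffix t i ⊨ ψ) (sym (∈-singletonₙ⁻ s∈)) (proj₁ (proj₂ (T⊨φUψ t Tt)))

    before-witness : (f' : TeamFun (nonZeroPart T f)) → Below T f f'
      → ∀ t q s → s ∈ₙ proj₁ (f' t q) → suffix t s ⊨ φ
    before-witness f' f'<f t q s s∈ =
      proj₂ (proj₂ (T⊨φUψ t (proj₁ q))) s (<ₛ-singletonₙ {f' t q} (witness t (proj₁ q)) (f'<f t q) s∈)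

  ⊨ˡ⇔⊆⊨ : (φ : Formula AP) (T : Team {AP}) → (T ⊨ˡ φ) ⇔ (T ⊆ (_⊨ φ))
  ⊨ˡ⇔⊆⊨ φ T = mk⇔ (sound φ) (complete φ)

  ⟦⟧-⊆⇔ : {P : Team {AP}} (t : Trace {AP}) → (⟦ t ⟧ ⊆ P) ⇔ P t
  ⟦⟧-⊆⇔ t = mk⇔ (λ t⊆P → t⊆P t refl) (λ Pt _ → λ { refl → Pt })

theorem5 : {AP : Set} (φ : Formula AP) →
    -- (1) downward closure
    ((T S : Team {AP}) → T ⊨ˡ φ → S ⊆ T → S ⊨ˡ φ)
    -- (2) empty team property
    × (∅ ⊨ˡ φ)
    -- (3) singleton equivalence
    × ((t : Trace {AP}) → (⟦ t ⟧ ⊨ˡ φ) ⇔ (t ⊨ φ))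
    -- (4) flatness
    × ((T : Team {AP}) → (T ⊨ˡ φ) ⇔ ((s : Trace {AP}) → T s → ⟦ s ⟧ ⊨ˡ φ))
theorem5 {AP} φ =
  (λ T S T⊨φ S⊆T → complete φ (λ s Ss → sound φ T⊨φ s (S⊆T s Ss))) ,
  complete φ (λ _ ()) ,
  singleton⇔ ,
  λ T → mk⇔ (λ T⊨φ s Ts → from (singleton⇔ s) (sound φ T⊨φ s Ts))
            (λ T⊨ˡφ-pointwise → complete φ λ s Ts → to (singleton⇔ s) (T⊨ˡφ-pointwise s Ts))
  where
  singleton⇔ : (t : Trace {AP}) → (⟦ t ⟧ ⊨ˡ φ) ⇔ (t ⊨ φ)
  singleton⇔ t = ⟦⟧-⊆⇔ t ⇔-∘ ⊨ˡ⇔⊆⊨ φ ⟦ t ⟧
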